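{- Let $x,y\in\mathbb Z_{>0}$. Let $\mathrm{Speh}(x,y)$ denote the multisegment $$\Big\{\big\langle \tfrac{1-x}{2}+\tfrac{y+1-2j}{2},\ \tfrac{x-1}{2}+\tfrac{y+1-2j}{2}\big\rangle : j=1,\dots,y\Big\},$$ and let $\rho(x,y)$ denote the multisegment $$\Big\{\big\langle \tfrac{1-r}{2},\tfrac{r-1}{2}\big\rangle : r=x+y-1,\ x+y-3,\ \dots,\ |x-y|+1\Big\}.$$ Then $\rho(x,y)<\mathrm{Speh}(x,y)$, i.e. $\rho(x,y)$ is obtained from $\mathrm{Speh}(x,y)$ by a chain of elementary operations.
   Context: For $a,b\in\mathbb Q$ with $b-a\in\mathbb Z$, the segment $\langle a,b\rangle$ is $\{a,a+1,\dots,b\}$ (empty if $b<a$). A multisegment is a finite multiset of nonempty segments. Two segments $S,S'$ are linked if $S\not\subset S'$, $S'\not\subset S$, and $S\cup S'$ is a segment. An elementary operation on a multisegment replaces a pair $\{S,S'\}$ of linked segments by $\{S\cup S',S\cap S'\}$ (omitting $S\cap S'$ if empty). For multisegments $a,b$ one writes $b<a$ if $b$ can be obtained from $a$ by a chain of (zero or more) elementary operations. (Representation-theoretically, $\mathrm{Speh}(x,y)$ corresponds to the Speh representation of $GL_{xy}$ and $\rho(x,y)$ to the product $\mathrm{St}_{GL_{x+y-1}}\times\mathrm{St}_{GL_{x+y-3}}\times\cdots\times\mathrm{St}_{GL_{|x-y|+1}}$ of Steinberg representations, in Zelevinsky's classification.) -}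

module Defs where

open import Data.Nat as ℕ using (ℕ; zero; suc; _∸_; _≤_)
open import Data.Integer as ℤ using (ℤ; +_)
open import Data.Rational as ℚ using (ℚ)
open import Data.List using (List; []; _∷_; map; upTo)
open import Data.List.Relation.Binary.Permutation.Propositional using (_↭_)
open import Data.Product using (Σ; ∃; ∃-syntax; _×_; _,_)
open import Data.Sum using (_⊎_)
open import Relation.Nullary using (¬_)
open import Relation.Binary.PropositionalEquality using (_≡_)
open import Relation.Binary.Construct.Closure.ReflexiveTransitive using (Star)
open import Function.Bundles using (_⇔_)

-- A nonempty segment ⟨a, b⟩ with a ∈ ℚ and b - a ∈ ℕ, represented by its
-- start a and b - a = len; so the segment is {a, a+1, ..., a+len}.
record Segment : Set where
  constructor seg
  field
    start : ℚ
    len   : ℕ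
open Segment public

end : Segment → ℚ
end S = start S ℚ.+ (+ len S ℚ./ 1)

_∈ₛ_ : ℚ → Segment → Set
q ∈ₛ S = ∃[ k ] (k ≤ len S × q ≡ start S ℚ.+ (+ k ℚ./ 1))

_⊆ₛ_ : Segment → Segment → Set
S ⊆ₛ S' = ∀ q → q ∈ₛ S → q ∈ₛ S'

IsUnion : Segment → Segment → Segment → Set
IsUnion S S' T = ∀ q → (q ∈ₛ T) ⇔ (q ∈ₛ S ⊎ q ∈ₛ S')

IsInter : Segment → Segment → Segment → Set
IsInter S S' T = ∀ q → (q ∈ₛ T) ⇔ (q ∈ₛ S × q ∈ₛ S')

InterEmpty : Segment → Segment → Set
InterEmpty S S' = ∀ q → q ∈ₛ S → q ∈ₛ S' → ⊥'
  where open import Data.Empty renaming (⊥ to ⊥')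

Linked : Segment → Segment → Set
Linked S S' = ¬ (S ⊆ₛ S') × ¬ (S' ⊆ₛ S) × ∃[ T ] IsUnion S S' T

-- multisegments: finite multisets of (nonempty) segments, as lists up to
-- permutation
Multisegment : Set
Multisegment = List Segment

ElemOp : Multisegment → Multisegment → Set
ElemOp a b =
  ∃[ S ] ∃[ S' ] ∃[ rest ]
    (a ↭ (S ∷ S' ∷ rest)) × Linked S S' ×
    (∃[ U ] IsUnion S S' U ×
      ((InterEmpty S S' × b ↭ (U ∷ rest))
       ⊎ (∃[ I ] IsInter S S' I × b ↭ (U ∷ I ∷ rest))))

_≺_ : Multisegment → Multisegment → Set
b ≺ a = Star ElemOp a b

⟨_+_⟩ : ℚ → ℕ → Segment
⟨ a + n ⟩ = seg a n

half : ℤ → ℚ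
half z = z ℚ./ 2

spehSeg : ℕ → ℕ → ℕ → Segment
spehSeg x y j =
  ⟨ half (+ 1 ℤ.- + x) ℚ.+ half (+ (y ℕ.+ 1) ℤ.- + (2 ℕ.* j)) + (x ∸ 1) ⟩

Speh : ℕ → ℕ → Multisegment
Speh x y = map (λ i → spehSeg x y (suc i)) (upTo y)

rhoSeg : ℕ → ℕ → ℕ → Segment
rhoSeg x y i = ⟨ half (+ 1 ℤ.- + r) + (r ∸ 1) ⟩
  where r = (x ℕ.+ y ∸ 1) ∸ (2 ℕ.* i)

ρ : ℕ → ℕ → Multisegment
ρ x y = map (rhoSeg x y) (upTo (x ℕ.⊓ y))

-- Write x = p + 1 and y = q + 1. Every segment of Speh(x,y) and of ρ(x,y) starts on the
-- lattice -(p+q)/2 + ℕ. Writing ⟦ i , n ⟧ for the segment of length n starting at the i-th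
-- lattice point, Speh(x,y) is the staircase ⟦ q , p ⟧, ..., ⟦ 1 , p ⟧, ⟦ 0 , p ⟧ and ρ(x,y) is the
-- concentric family ⟦ i , p + q - 2i ⟧, 0 ≤ i ≤ min(p,q). Induct on q: to add the top step
-- ⟦ q+1 , p ⟧ to the concentric family of the lower staircase, merge it with the outermost
-- member, then merge the resulting intersection with the next member, and so on. Each merge
-- lengthens one member by one to the right; the carried segment shrinks by one each time and
-- either vanishes (p ≤ q) or survives as the new innermost member (p > q).

module Submission where

open import Defs
open import Data.Nat using (ℕ; zero; suc; _+_; _*_; _∸_; _≤_; _<_; _>_; _⊓_; ∣_-_∣; s≤s; z<s)
open import Data.Nat.Properties
open import Data.Nat.Tactic.RingSolver using (solve; solve-∀)
open import Data.Integer as ℤ using (+_)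
import Data.Integer.Properties as ℤ
open import Data.Integer.Tactic.RingSolver as ℤSolver using ()
open import Data.Rational as ℚ using (ℚ)
import Data.Rational.Properties as ℚ
open import Data.Rational.Unnormalised as ℚᵘ using (mkℚᵘ; *≡*)
import Data.Rational.Unnormalised.Properties as ℚᵘ
open import Algebra.Properties.Group ℚ.+-0-group using (∙-cancelˡ)
open import Data.List using ([]; _∷_; applyUpTo)
open import Data.List.Properties using (map-upTo)
open import Data.List.Relation.Binary.Permutation.Propositional using (_↭_; prep; swap; ↭-refl; ↭-sym; ↭-trans)
open import Data.List.Relation.Binary.Permutation.Propositional.Properties using (shift)
open import Data.Product using (∃-syntax; _×_; _,_)
open import Data.Sum using (_⊎_; inj₁; inj₂)
open import Data.Empty using (⊥)
open import Relation.Nullary using (¬_; yes; no)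
open import Function.Bundles using (_⇔_; mk⇔; module Equivalence)
open import Relation.Binary.PropositionalEquality
open import Relation.Binary.Construct.Closure.ReflexiveTransitive using (ε; _◅_; _◅◅_; gmap)

ι : ℕ → ℚ
ι n = + n ℚ./ 1

fromℚᵘ-+ : ∀ p q → ℚ.fromℚᵘ p ℚ.+ ℚ.fromℚᵘ q ≡ ℚ.fromℚᵘ (p ℚᵘ.+ q)
fromℚᵘ-+ p q = trans (sym (ℚ.fromℚᵘ-toℚᵘ _))
  (ℚ.fromℚᵘ-cong {ℚ.toℚᵘ (ℚ.fromℚᵘ p ℚ.+ ℚ.fromℚᵘ q)} {p ℚᵘ.+ q}
    (ℚᵘ.≃-trans (ℚ.toℚᵘ-homo-+ (ℚ.fromℚᵘ p) (ℚ.fromℚᵘ q))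
                (ℚᵘ.+-cong (ℚ.toℚᵘ-fromℚᵘ p) (ℚ.toℚᵘ-fromℚᵘ q))))

half-+ : ∀ a b → half a ℚ.+ half b ≡ half (a ℤ.+ b)
half-+ a b = trans (fromℚᵘ-+ (mkℚᵘ a 1) (mkℚᵘ b 1))
  (ℚ.fromℚᵘ-cong {mkℚᵘ a 1 ℚᵘ.+ mkℚᵘ b 1} {mkℚᵘ (a ℤ.+ b) 1} (*≡* (cross a b)))
  where
  cross : ∀ a b → (a ℤ.* + 2 ℤ.+ b ℤ.* + 2) ℤ.* + 2 ≡ (a ℤ.+ b) ℤ.* + 4
  cross = ℤSolver.solve-∀

ι-half : ∀ n → ι n ≡ half (+ n ℤ.+ + n)
ι-half n = ℚ.fromℚᵘ-cong {mkℚᵘ (+ n) 0} {mkℚᵘ (+ n ℤ.+ + n) 1} (*≡* (cross (+ n)))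
  where
  cross : ∀ z → z ℤ.* + 2 ≡ (z ℤ.+ z) ℤ.* + 1
  cross = ℤSolver.solve-∀

half-+-ι : ∀ z n → half z ℚ.+ ι n ≡ half (z ℤ.+ (+ n ℤ.+ + n))
half-+-ι z n = trans (cong (half z ℚ.+_) (ι-half n)) (half-+ z (+ n ℤ.+ + n))

ι-+ : ∀ m n → ι m ℚ.+ ι n ≡ ι (m + n)
ι-+ m n = trans (fromℚᵘ-+ (mkℚᵘ (+ m) 0) (mkℚᵘ (+ n) 0))
  (ℚ.fromℚᵘ-cong {mkℚᵘ (+ m) 0 ℚᵘ.+ mkℚᵘ (+ n) 0} {mkℚᵘ (+ (m + n)) 0} (*≡* cross))
  where
  identity : ∀ x y → (x ℤ.* + 1 ℤ.+ y ℤ.* + 1) ℤ.* + 1 ≡ (x ℤ.+ y) ℤ.* + 1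
  identity = ℤSolver.solve-∀
  cross : (+ m ℤ.* + 1 ℤ.+ + n ℤ.* + 1) ℤ.* + 1 ≡ + (m + n) ℤ.* + 1
  cross rewrite ℤ.pos-+ m n = identity (+ m) (+ n)

ι-injective : ∀ {m n} → ι m ≡ ι n → m ≡ n
ι-injective {m} {n} e with ℚ.fromℚᵘ-injective {mkℚᵘ (+ m) 0} {mkℚᵘ (+ n) 0} e
... | *≡* h = ℤ.+-injective (trans (sym (ℤ.*-identityʳ (+ m))) (trans h (ℤ.*-identityʳ (+ n))))

ElemOp-∷ : ∀ c {a b} → ElemOp a b → ElemOp (c ∷ a) (c ∷ b)
ElemOp-∷ c (S , S' , rest , a↭ , linked , U , union , result) =
  S , S' , c ∷ rest , ↭-trans (prep c a↭) (↭-sym (shift c (S ∷ S' ∷ []) rest)) , linked , U , union , lift result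
  where
  lift : ∀ {b} → (InterEmpty S S' × b ↭ U ∷ rest) ⊎ (∃[ I ] IsInter S S' I × b ↭ U ∷ I ∷ rest) →
         (InterEmpty S S' × c ∷ b ↭ U ∷ c ∷ rest) ⊎ (∃[ I ] IsInter S S' I × c ∷ b ↭ U ∷ I ∷ c ∷ rest)
  lift (inj₁ (empty , b↭)) = inj₁ (empty , ↭-trans (prep c b↭) (↭-sym (shift c (U ∷ []) rest)))
  lift (inj₂ (I , inter , b↭)) = inj₂ (I , inter , ↭-trans (prep c b↭) (↭-sym (shift c (U ∷ I ∷ []) rest)))

≺-∷ : ∀ c {a b} → b ≺ a → (c ∷ b) ≺ (c ∷ a)
≺-∷ c = gmap (c ∷_) (ElemOp-∷ c)

_∈[_,_] : ℕ → ℕ → ℕ → Set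
m ∈[ a , b ] = a ≤ m × m ≤ b

∈[]-∪ : ∀ {a b e f} → a ≤ b → b ≤ suc e → e ≤ f → ∀ m → m ∈[ a , f ] ⇔ (m ∈[ a , e ] ⊎ m ∈[ b , f ])
∈[]-∪ {a} {b} {e} {f} a≤b b≤1+e e≤f m = mk⇔ to from
  where
  to : m ∈[ a , f ] → m ∈[ a , e ] ⊎ m ∈[ b , f ]
  to (a≤m , m≤f) with m ≤? e
  ... | yes m≤e = inj₁ (a≤m , m≤e)
  ... | no  m≰e = inj₂ (≤-trans b≤1+e (≰⇒> m≰e) , m≤f)
  from : m ∈[ a , e ] ⊎ m ∈[ b , f ] → m ∈[ a , f ]
  from (inj₁ (a≤m , m≤e)) = a≤m , ≤-trans m≤e e≤f
  from (inj₂ (b≤m , m≤f)) = ≤-trans a≤b b≤m , m≤f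

∈[]-∩ : ∀ {a b e f} → a ≤ b → e ≤ f → ∀ m → m ∈[ b , e ] ⇔ (m ∈[ a , e ] × m ∈[ b , f ])
∈[]-∩ a≤b e≤f m = mk⇔
  (λ (b≤m , m≤e) → (≤-trans a≤b b≤m , m≤e) , (b≤m , ≤-trans m≤e e≤f))
  (λ ((_ , m≤e) , (b≤m , _)) → b≤m , m≤e)

∈[]-disjoint : ∀ {a b e f} → e < b → ∀ m → m ∈[ a , e ] → m ∈[ b , f ] → ⊥
∈[]-disjoint e<b m (_ , m≤e) (b≤m , _) = <⇒≱ e<b (≤-trans b≤m m≤e)

module Grid (origin : ℚ) where

  -- abstract, so that Agda can infer the index i from ⟦ i , n ⟧
  abstract
    pt : ℕ → ℚ
    pt i = origin ℚ.+ ι i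

    pt-def : ∀ i → pt i ≡ origin ℚ.+ ι i
    pt-def i = refl

    pt-+ : ∀ i k → pt i ℚ.+ ι k ≡ pt (i + k)
    pt-+ i k = trans (ℚ.+-assoc origin (ι i) (ι k)) (cong (origin ℚ.+_) (ι-+ i k))

    pt-injective : ∀ {m n} → pt m ≡ pt n → m ≡ n
    pt-injective e = ι-injective (∙-cancelˡ origin _ _ e)

  ⟦_,_⟧ : ℕ → ℕ → Segment
  ⟦ i , n ⟧ = ⟨ pt i + n ⟩

  ∈⟦⟧⇒ : ∀ {q i n} → q ∈ₛ ⟦ i , n ⟧ → ∃[ m ] (m ∈[ i , i + n ] × q ≡ pt m)
  ∈⟦⟧⇒ {i = i} (k , k≤n , q≡) = i + k , (m≤m+n i k , +-monoʳ-≤ i k≤n) , trans q≡ (pt-+ i k)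

  pt∈⟦⟧ : ∀ {m i n} → m ∈[ i , i + n ] → pt m ∈ₛ ⟦ i , n ⟧
  pt∈⟦⟧ {m} {i} {n} (i≤m , m≤i+n) =
    m ∸ i , subst (m ∸ i ≤_) (m+n∸m≡n i n) (∸-monoˡ-≤ i m≤i+n) ,
    trans (cong pt (sym (m+[n∸m]≡n i≤m))) (sym (pt-+ i (m ∸ i)))

  pt∈⟦⟧⁻¹ : ∀ {m i n} → pt m ∈ₛ ⟦ i , n ⟧ → m ∈[ i , i + n ]
  pt∈⟦⟧⁻¹ m∈ with ∈⟦⟧⇒ m∈
  ... | _ , m'∈ , e = subst (_∈[ _ , _ ]) (sym (pt-injective e)) m'∈

  ⊈-from-ℕ : ∀ {i u j v} m → m ∈[ i , i + u ] → ¬ m ∈[ j , j + v ] → ¬ ⟦ i , u ⟧ ⊆ₛ ⟦ j , v ⟧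
  ⊈-from-ℕ m m∈ m∉ ⊆ = m∉ (pt∈⟦⟧⁻¹ (⊆ (pt m) (pt∈⟦⟧ m∈)))

  ∪-from-ℕ : ∀ {i u j v k w} → (∀ m → m ∈[ k , k + w ] ⇔ (m ∈[ i , i + u ] ⊎ m ∈[ j , j + v ])) →
             IsUnion ⟦ i , u ⟧ ⟦ j , v ⟧ ⟦ k , w ⟧
  ∪-from-ℕ {i} {u} {j} {v} {k} {w} ⇔ℕ q = mk⇔ to from
    where
    to : q ∈ₛ ⟦ k , w ⟧ → q ∈ₛ ⟦ i , u ⟧ ⊎ q ∈ₛ ⟦ j , v ⟧
    to q∈ with ∈⟦⟧⇒ q∈
    ... | m , m∈ , refl with Equivalence.to (⇔ℕ m) m∈
    ...   | inj₁ m∈S  = inj₁ (pt∈⟦⟧ m∈S)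
    ...   | inj₂ m∈S' = inj₂ (pt∈⟦⟧ m∈S')
    from : q ∈ₛ ⟦ i , u ⟧ ⊎ q ∈ₛ ⟦ j , v ⟧ → q ∈ₛ ⟦ k , w ⟧
    from (inj₁ q∈) with ∈⟦⟧⇒ q∈
    ... | m , m∈ , refl = pt∈⟦⟧ (Equivalence.from (⇔ℕ m) (inj₁ m∈))
    from (inj₂ q∈) with ∈⟦⟧⇒ q∈
    ... | m , m∈ , refl = pt∈⟦⟧ (Equivalence.from (⇔ℕ m) (inj₂ m∈))

  ∩-from-ℕ : ∀ {i u j v k w} → (∀ m → m ∈[ k , k + w ] ⇔ (m ∈[ i , i + u ] × m ∈[ j , j + v ])) →
             IsInter ⟦ i , u ⟧ ⟦ j , v ⟧ ⟦ k , w ⟧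
  ∩-from-ℕ {i} {u} {j} {v} {k} {w} ⇔ℕ q = mk⇔ to from
    where
    to : q ∈ₛ ⟦ k , w ⟧ → q ∈ₛ ⟦ i , u ⟧ × q ∈ₛ ⟦ j , v ⟧
    to q∈ with ∈⟦⟧⇒ q∈
    ... | m , m∈ , refl with Equivalence.to (⇔ℕ m) m∈
    ...   | m∈S , m∈S' = pt∈⟦⟧ m∈S , pt∈⟦⟧ m∈S'
    from : q ∈ₛ ⟦ i , u ⟧ × q ∈ₛ ⟦ j , v ⟧ → q ∈ₛ ⟦ k , w ⟧
    from (q∈S , q∈S') with ∈⟦⟧⇒ q∈S
    ... | m , m∈ , refl = pt∈⟦⟧ (Equivalence.from (⇔ℕ m) (m∈ , pt∈⟦⟧⁻¹ q∈S'))

  ∩-empty-from-ℕ : ∀ {i u j v} → (∀ m → m ∈[ i , i + u ] → m ∈[ j , j + v ] → ⊥) →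
                   InterEmpty ⟦ i , u ⟧ ⟦ j , v ⟧
  ∩-empty-from-ℕ disjoint q q∈S q∈S' with ∈⟦⟧⇒ q∈S
  ... | m , m∈ , refl = disjoint m m∈ (pt∈⟦⟧⁻¹ q∈S')

  ∪-adjacent : ∀ {i u j v w} → i ≤ j → j ≤ suc (i + u) → i + u ≤ j + v → i + w ≡ j + v →
               IsUnion ⟦ i , u ⟧ ⟦ j , v ⟧ ⟦ i , w ⟧
  ∪-adjacent {i} {u} {j} {v} {w} i≤j j≤ ≤end end≡ = ∪-from-ℕ λ m →
    subst (λ f → m ∈[ i , i + w ] ⇔ (m ∈[ i , i + u ] ⊎ m ∈[ j , f ])) end≡
      (∈[]-∪ i≤j j≤ (subst (i + u ≤_) (sym end≡) ≤end) m)

  linked : ∀ {i u j v w} → i < j → j ≤ suc (i + u) → i + u < j + v → i + w ≡ j + v →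
           Linked ⟦ i , u ⟧ ⟦ j , v ⟧
  linked {i} {u} {j} {v} {w} i<j j≤ <end end≡ =
    ⊈-from-ℕ i (≤-refl , m≤m+n i u) (λ (j≤i , _) → <⇒≱ i<j j≤i) ,
    ⊈-from-ℕ (j + v) (m≤m+n j v , ≤-refl) (λ (_ , ≤i+u) → <⇒≱ <end ≤i+u) ,
    ⟦ i , w ⟧ , ∪-adjacent (<⇒≤ i<j) j≤ (<⇒≤ <end) end≡

  elemOp-disjoint : ∀ i u j v w {rest} → j ≡ suc (i + u) → i + w ≡ j + v →
                    ElemOp (⟦ j , v ⟧ ∷ ⟦ i , u ⟧ ∷ rest) (⟦ i , w ⟧ ∷ rest)
  elemOp-disjoint i u _ v w {rest} refl end≡ =
    ⟦ i , u ⟧ , ⟦ suc (i + u) , v ⟧ , rest , swap _ _ ↭-refl , linked i<j ≤-refl <end end≡ ,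
    ⟦ i , w ⟧ , ∪-adjacent (<⇒≤ i<j) ≤-refl (<⇒≤ <end) end≡ ,
    inj₁ (∩-empty-from-ℕ (∈[]-disjoint ≤-refl) , ↭-refl)
    where
    i<j : i < suc (i + u)
    i<j = s≤s (m≤m+n i u)
    <end : i + u < suc (i + u) + v
    <end = m≤m+n (suc (i + u)) v

  elemOp-overlap : ∀ i u j v w x {rest} → i < j → j + x ≡ i + u → i + u < j + v → i + w ≡ j + v →
                   ElemOp (⟦ j , v ⟧ ∷ ⟦ i , u ⟧ ∷ rest) (⟦ i , w ⟧ ∷ ⟦ j , x ⟧ ∷ rest)
  elemOp-overlap i u j v w x {rest} i<j inter≡ <end end≡ =
    ⟦ i , u ⟧ , ⟦ j , v ⟧ , rest , swap _ _ ↭-refl , linked i<j j≤ <end end≡ ,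
    ⟦ i , w ⟧ , ∪-adjacent (<⇒≤ i<j) j≤ (<⇒≤ <end) end≡ ,
    inj₂ (⟦ j , x ⟧ , ∩-from-ℕ inter , ↭-refl)
    where
    j≤ : j ≤ suc (i + u)
    j≤ = ≤-trans (subst (j ≤_) inter≡ (m≤m+n j x)) (n≤1+n (i + u))
    inter : ∀ m → m ∈[ j , j + x ] ⇔ (m ∈[ i , i + u ] × m ∈[ j , j + v ])
    inter m = subst (λ e → m ∈[ j , e ] ⇔ (m ∈[ i , i + u ] × m ∈[ j , j + v ])) (sym inter≡)
      (∈[]-∩ (<⇒≤ i<j) (<⇒≤ <end) m)

  -- c segments with a common centre, the innermost one ⟦ b + c - 1 , L ⟧
  concentric : ℕ → ℕ → ℕ → Multisegment
  concentric b L zero    = []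
  concentric b L (suc c) = ⟦ b , c + c + L ⟧ ∷ concentric (suc b) L c

  concentric-absorb-short : ∀ b c L {j} → j ≡ b + suc c + L →
                            concentric b (suc L) (suc c) ≺ (⟦ j , c ⟧ ∷ concentric b L (suc c))
  concentric-absorb-short b zero L refl =
    elemOp-disjoint b L (b + 1 + L) 0 (suc L) (solve (b ∷ L ∷ [])) (solve (b ∷ L ∷ [])) ◅ ε
  concentric-absorb-short b (suc c) L refl =
    elemOp-overlap b (suc c + suc c + L) (b + suc (suc c) + L) (suc c) (suc c + suc c + suc L) c
      (≤-trans (m<m+n b z<s) (m≤m+n _ L))
      (solve (b ∷ c ∷ L ∷ [])) (≤-reflexive (solve (b ∷ c ∷ L ∷ []))) (solve (b ∷ c ∷ L ∷ [])) ◅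
    ≺-∷ _ (concentric-absorb-short (suc b) c L (cong (_+ L) (+-suc b (suc c))))

  concentric-absorb-long : ∀ b c d {j} → j ≡ b + c →
                           concentric b d (suc c) ≺ (⟦ j , c + d ⟧ ∷ concentric b (suc d) c)
  concentric-absorb-long b zero d refl =
    subst (λ j → (⟦ b , d ⟧ ∷ []) ≺ (⟦ j , d ⟧ ∷ [])) (sym (+-identityʳ b)) ε
  concentric-absorb-long b (suc c) d refl =
    elemOp-overlap b (c + c + suc d) (b + suc c) (suc c + d) (suc c + suc c + d) (c + d)
      (m<m+n b z<s)
      (solve (b ∷ c ∷ d ∷ [])) (≤-reflexive (solve (b ∷ c ∷ d ∷ []))) (solve (b ∷ c ∷ d ∷ [])) ◅
    ≺-∷ _ (concentric-absorb-long (suc b) c d (+-suc b c))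

  staircase : ℕ → ℕ → Multisegment
  staircase p zero    = ⟦ 0 , p ⟧ ∷ []
  staircase p (suc q) = ⟦ suc q , p ⟧ ∷ staircase p q

  ρ-grid : ℕ → ℕ → Multisegment
  ρ-grid p q = concentric 0 ∣ p - q ∣ (suc (p ⊓ q))

  ρ-grid-≤ : ∀ p d {q} → p + d ≡ q → ρ-grid p q ≡ concentric 0 d (suc p)
  ρ-grid-≤ p d refl = cong₂ (λ L c → concentric 0 L (suc c)) (∣m-m+n∣≡n p d) (m≤n⇒m⊓n≡m (m≤m+n p d))

  ρ-grid-≥ : ∀ q d {p} → q + d ≡ p → ρ-grid p q ≡ concentric 0 d (suc q)
  ρ-grid-≥ q d refl = cong₂ (λ L c → concentric 0 L (suc c))
    (trans (∣-∣-comm (q + d) q) (∣m-m+n∣≡n q d)) (m≥n⇒m⊓n≡n (m≤m+n q d))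

  ρ-grid-extend : ∀ p q → ρ-grid p (suc q) ≺ (⟦ suc q , p ⟧ ∷ ρ-grid p q)
  ρ-grid-extend p q with ≤-<-connex p q
  ... | inj₁ p≤q = subst₂ (λ a b → a ≺ (⟦ suc q , p ⟧ ∷ b))
    (sym (ρ-grid-≤ p (suc d) (trans (+-suc p d) (cong suc p+d≡q)))) (sym (ρ-grid-≤ p d p+d≡q))
    (concentric-absorb-short 0 p d (cong suc (sym p+d≡q)))
    where
    d = q ∸ p
    p+d≡q : p + d ≡ q
    p+d≡q = m+[n∸m]≡n p≤q
  ... | inj₂ q<p = subst₂ _≺_
    (sym (ρ-grid-≥ (suc q) d 1+q+d≡p))
    (cong₂ (λ n b → ⟦ suc q , n ⟧ ∷ b) 1+q+d≡p (sym (ρ-grid-≥ q (suc d) (trans (+-suc q d) 1+q+d≡p))))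
    (concentric-absorb-long 0 (suc q) d refl)
    where
    d = p ∸ suc q
    1+q+d≡p : suc q + d ≡ p
    1+q+d≡p = m+[n∸m]≡n q<p

  ρ-grid≺staircase : ∀ p q → ρ-grid p q ≺ staircase p q
  ρ-grid≺staircase p zero    = subst (_≺ staircase p 0) (sym (ρ-grid-≥ 0 p refl)) ε
  ρ-grid≺staircase p (suc q) = ≺-∷ ⟦ suc q , p ⟧ (ρ-grid≺staircase p q) ◅◅ ρ-grid-extend p q

  staircase-applyUpTo : ∀ p q (g : ℕ → Segment) → (∀ i → i < suc q → g i ≡ ⟦ q ∸ i , p ⟧) →
                        applyUpTo g (suc q) ≡ staircase p q
  staircase-applyUpTo p zero    g g≡ = cong (_∷ []) (g≡ 0 z<s)
  staircase-applyUpTo p (suc q) g g≡ =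
    cong₂ _∷_ (g≡ 0 z<s) (staircase-applyUpTo p q (λ i → g (suc i)) (λ i i<1+q → g≡ (suc i) (s≤s i<1+q)))

  concentric-applyUpTo : ∀ b L c (g : ℕ → Segment) →
                         (∀ i → i < c → g i ≡ ⟦ b + i , (c ∸ suc i) + (c ∸ suc i) + L ⟧) →
                         applyUpTo g c ≡ concentric b L c
  concentric-applyUpTo b L zero    g g≡ = refl
  concentric-applyUpTo b L (suc c) g g≡ =
    cong₂ _∷_ (trans (g≡ 0 z<s) (cong (λ s → ⟦ s , c + c + L ⟧) (+-identityʳ b)))
      (concentric-applyUpTo (suc b) L c (λ i → g (suc i))
        (λ i i<c → trans (g≡ (suc i) (s≤s i<c))
                         (cong (λ s → ⟦ s , (c ∸ suc i) + (c ∸ suc i) + L ⟧) (+-suc b i))))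

origin : ℕ → ℕ → ℚ
origin p q = half (ℤ.- + (p + q))

speh-start-numerator : ∀ p i t →
  (+ 1 ℤ.- + suc p) ℤ.+ (+ (suc (i + t) + 1) ℤ.- + (2 * suc i)) ≡ ℤ.- + (p + (i + t)) ℤ.+ (+ t ℤ.+ + t)
speh-start-numerator p i t
  rewrite ℤ.pos-+ 1 p | ℤ.pos-+ (suc (i + t)) 1 | ℤ.pos-+ 1 (i + t) | ℤ.pos-* 2 (suc i) | ℤ.pos-+ 1 i
        | ℤ.pos-+ p (i + t) | ℤ.pos-+ i t
  = identity (+ p) (+ i) (+ t)
  where
  identity : ∀ p i t → (+ 1 ℤ.- (+ 1 ℤ.+ p)) ℤ.+ ((+ 1 ℤ.+ (i ℤ.+ t) ℤ.+ + 1) ℤ.- + 2 ℤ.* (+ 1 ℤ.+ i)) ≡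
                       ℤ.- (p ℤ.+ (i ℤ.+ t)) ℤ.+ (t ℤ.+ t)
  identity = ℤSolver.solve-∀

rho-start-numerator : ∀ i k → + 1 ℤ.- + suc k ≡ ℤ.- + (i + i + k) ℤ.+ (+ i ℤ.+ + i)
rho-start-numerator i k rewrite ℤ.pos-+ 1 k | ℤ.pos-+ (i + i) k | ℤ.pos-+ i i = identity (+ i) (+ k)
  where
  identity : ∀ i k → + 1 ℤ.- (+ 1 ℤ.+ k) ≡ ℤ.- (i ℤ.+ i ℤ.+ k) ℤ.+ (i ℤ.+ i)
  identity = ℤSolver.solve-∀

spehSeg-on-grid : ∀ p {q} i t → i + t ≡ q → spehSeg (suc p) (suc q) (suc i) ≡ Grid.⟦_,_⟧ (origin p q) t p
spehSeg-on-grid p i t refl = cong (λ s → seg s p) (begin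
  half (+ 1 ℤ.- + suc p) ℚ.+ half (+ (suc (i + t) + 1) ℤ.- + (2 * suc i))
    ≡⟨ half-+ (+ 1 ℤ.- + suc p) (+ (suc (i + t) + 1) ℤ.- + (2 * suc i)) ⟩
  half ((+ 1 ℤ.- + suc p) ℤ.+ (+ (suc (i + t) + 1) ℤ.- + (2 * suc i)))
    ≡⟨ cong half (speh-start-numerator p i t) ⟩
  half (ℤ.- + (p + (i + t)) ℤ.+ (+ t ℤ.+ + t))
    ≡⟨ half-+-ι (ℤ.- + (p + (i + t))) t ⟨
  origin p (i + t) ℚ.+ ι t
    ≡⟨ Grid.pt-def (origin p (i + t)) t ⟨
  Grid.pt (origin p (i + t)) t ∎)
  where open ≡-Reasoning

rhoSeg-on-grid : ∀ p q i t L → p + q ≡ (i + t) + (i + t) + L →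
                 rhoSeg (suc p) (suc q) i ≡ Grid.⟦_,_⟧ (origin p q) i (t + t + L)
rhoSeg-on-grid p q i t L p+q≡ =
  trans (cong (λ r → ⟨ half (+ 1 ℤ.- + r) + (r ∸ 1) ⟩) r≡) (cong (λ s → seg s k) (begin
  half (+ 1 ℤ.- + suc k)                   ≡⟨ cong half (rho-start-numerator i k) ⟩
  half (ℤ.- + (i + i + k) ℤ.+ (+ i ℤ.+ + i)) ≡⟨ half-+-ι (ℤ.- + (i + i + k)) i ⟨
  half (ℤ.- + (i + i + k)) ℚ.+ ι i         ≡⟨ cong (λ n → half (ℤ.- + n) ℚ.+ ι i) p+q≡i+i+k ⟨
  origin p q ℚ.+ ι i                       ≡⟨ Grid.pt-def (origin p q) i ⟨
  Grid.pt (origin p q) i                   ∎))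
  where
  open ≡-Reasoning
  k = t + t + L
  regroup : ∀ i t L → (i + t) + (i + t) + L ≡ i + i + (t + t + L)
  regroup = solve-∀
  p+q≡i+i+k : p + q ≡ i + i + k
  p+q≡i+i+k = trans p+q≡ (regroup i t L)
  doubling : ∀ i K → suc (i + i + K) ≡ 2 * i + suc K
  doubling = solve-∀
  r≡ : (p + suc q) ∸ 2 * i ≡ suc k
  r≡ = trans (cong (_∸ 2 * i) (trans (+-suc p q) (trans (cong suc p+q≡i+i+k) (doubling i k))))
             (m+n∸m≡n (2 * i) (suc k))

m⊓n+m⊓n+∣m-n∣≡m+n : ∀ m n → m ⊓ n + m ⊓ n + ∣ m - n ∣ ≡ m + n
m⊓n+m⊓n+∣m-n∣≡m+n zero    n       = refl
m⊓n+m⊓n+∣m-n∣≡m+n (suc m) zero    = sym (+-identityʳ (suc m))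
m⊓n+m⊓n+∣m-n∣≡m+n (suc m) (suc n) = cong suc (begin
  m ⊓ n + suc (m ⊓ n) + ∣ m - n ∣ ≡⟨ cong (_+ ∣ m - n ∣) (+-suc (m ⊓ n) (m ⊓ n)) ⟩
  suc (m ⊓ n + m ⊓ n + ∣ m - n ∣) ≡⟨ cong suc (m⊓n+m⊓n+∣m-n∣≡m+n m n) ⟩
  suc (m + n)                     ≡⟨ +-suc m n ⟨
  m + suc n                       ∎)
  where open ≡-Reasoning

proposition3p3p1 : (x y : ℕ) → x > 0 → y > 0 → ρ x y ≺ Speh x y
proposition3p3p1 (suc p) (suc q) _ _ =
  subst₂ _≺_ (sym ρ≡ρ-grid) (sym Speh≡staircase) (ρ-grid≺staircase p q)
  where
  open Grid (origin p q)
  m = p ⊓ q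
  Speh≡staircase : Speh (suc p) (suc q) ≡ staircase p q
  Speh≡staircase = trans (map-upTo _ (suc q)) (staircase-applyUpTo p q _
    λ i i≤q → spehSeg-on-grid p i (q ∸ i) (m+[n∸m]≡n (≤-pred i≤q)))
  ρ≡ρ-grid : ρ (suc p) (suc q) ≡ ρ-grid p q
  ρ≡ρ-grid = trans (map-upTo _ (suc m)) (concentric-applyUpTo 0 ∣ p - q ∣ (suc m) _
    λ i i≤m → rhoSeg-on-grid p q i (m ∸ i) ∣ p - q ∣
      (trans (sym (m⊓n+m⊓n+∣m-n∣≡m+n p q))
             (cong (λ n → n + n + ∣ p - q ∣) (sym (m+[n∸m]≡n (≤-pred i≤m))))))
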